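{- Let $n_1, n_2$ be positive integers with $n_1 \mid n_2$, and let $\ell$ be an integer with $\ell \geq 4$ and $\ell \nmid n_2$. Then there exists a zero-sum sequence in $\mathbb{Z}/n_1\mathbb{Z} \times \mathbb{Z}/n_2\mathbb{Z}$ of length $2n_2 - \ell$ which contains no zero-sum subsequence of length $n_2$.
   Context: A sequence in an abelian group is a finite list of elements (repetitions allowed); a subsequence is obtained by selecting any subset of the positions (not necessarily consecutive). A sequence is zero-sum if its terms sum to $0$. -}

module Defs where

open import Data.Nat using (ℕ; _+_)
open import Data.Nat.Divisibility using (_∣_)
open import Data.Fin using (Fin; toℕ)
open import Data.Product using (_×_; proj₁; proj₂)
open import Data.List using (List; map)
open import Data.Nat.ListAction using (sum)
open import Data.Product using (_×_)

G : ℕ → ℕ → Set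
G n₁ n₂ = Fin n₁ × Fin n₂

-- A sequence (finite list, repetitions allowed) is zero-sum iff its terms sum
-- to 0 in ℤ/n₁ℤ × ℤ/n₂ℤ, i.e. the sums of the residue representatives are
-- divisible by n₁ resp. n₂ in each coordinate.
ZeroSum : (n₁ n₂ : ℕ) → List (G n₁ n₂) → Set
ZeroSum n₁ n₂ S =
  (n₁ ∣ sum (map (λ g → toℕ (proj₁ g)) S)) × (n₂ ∣ sum (map (λ g → toℕ (proj₂ g)) S))

module Submission where

-- Proof idea.  Only the second coordinate matters: every sequence below lives
-- in {0} × ℤ/n₂ℤ.  Write n = n₂.
--
-- * If ℓ > n, the constant sequence 0, …, 0 of length 2n ∸ ℓ < n is zero-sum
--   and too short to contain any subsequence of length n.
-- * If ℓ < n, divide: n = Qℓ + R with Q ≥ 1 and 1 ≤ R < ℓ (R ≠ 0 as ℓ ∤ n).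
--   Put v = n − Q and take S = aˣ bʸ with a = (0, v − 1), b = (0, v),
--   x = Qℓ = n − R and y = (Q − 1)ℓ + 2R = n − (ℓ − R), so |S| = 2n − ℓ.
--   Since ℓv ≡ R (mod n), S is zero-sum.  A length-n subsequence aⁱ bʲ has
--   second coordinate sum n(v − 1) + j, so it is zero-sum only if n ∣ j;
--   as j ≤ y < n this forces j = 0, hence i = n > x, which is impossible.

open import Defs
open import Data.Nat using (ℕ; _+_; _*_; _∸_; _≤_; _>_; _<_; zero; suc; z≤n; s≤s)
open import Data.Nat.Properties
open import Data.Nat.Divisibility using (_∣_; divides; ∣-refl; ∣m+n∣m⇒∣n; m∣m*n; _∣0; ∣⇒≤)
open import Data.Nat.DivMod using (_/_; _%_; m≡m%n+[m/n]*n; m%n<n)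
open import Data.Nat.ListAction using (sum)
open import Data.Nat.ListAction.Properties using (sum-++)
open import Data.Nat.Tactic.RingSolver using (solve-∀)
open import Data.List using (List; length; []; _∷_; _++_; replicate; map)
open import Data.List.Properties using (map-++; map-replicate; length-replicate; length-++)
open import Data.List.Relation.Binary.Sublist.Propositional using (_⊆_)
open import Data.List.Relation.Binary.Sublist.Heterogeneous using ([]; _∷ʳ_; _∷_)
open import Data.List.Relation.Binary.Sublist.Heterogeneous.Properties using (length-mono-≤)
open import Data.Fin using (toℕ; fromℕ<) renaming (zero to fzero)
open import Data.Fin.Properties using (toℕ-fromℕ<)
open import Data.Product using (Σ; _×_; _,_; proj₁; proj₂)
open import Data.Empty using (⊥-elim)
open import Relation.Nullary using (¬_)
open import Relation.Binary.Definitions using (tri<; tri≈; tri>)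
open import Relation.Binary.PropositionalEquality

NoZeroSumSubsequenceOfLength : (n₁ n₂ : ℕ) → List (G n₁ n₂) → Set
NoZeroSumSubsequenceOfLength n₁ n₂ S =
  (T : List (G n₁ n₂)) → T ⊆ S → length T ≡ n₂ → ¬ ZeroSum n₁ n₂ T

Witness : (n₁ n₂ ℓ : ℕ) → Set
Witness n₁ n₂ ℓ = Σ (List (G n₁ n₂)) (λ S →
  (length S ≡ 2 * n₂ ∸ ℓ) × ZeroSum n₁ n₂ S × NoZeroSumSubsequenceOfLength n₁ n₂ S)

module _ {A : Set} where

  sublist-of-block : (b : A) (y : ℕ) (T : List A) → T ⊆ replicate y b →
    (T ≡ replicate (length T) b) × (length T ≤ y)
  sublist-of-block b zero .[] [] = refl , z≤n
  sublist-of-block b (suc y) T (.b ∷ʳ T⊆) with sublist-of-block b y T T⊆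
  ... | T≡ , j≤y = T≡ , m≤n⇒m≤1+n j≤y
  sublist-of-block b (suc y) (.b ∷ T) (refl ∷ T⊆) with sublist-of-block b y T T⊆
  ... | T≡ , j≤y = cong (b ∷_) T≡ , s≤s j≤y

  sublist-of-two-blocks : (a b : A) (x y : ℕ) (T : List A) →
    T ⊆ replicate x a ++ replicate y b →
    Σ ℕ λ i → Σ ℕ λ j → (T ≡ replicate i a ++ replicate j b) × i ≤ x × j ≤ y
  sublist-of-two-blocks a b zero y T T⊆ with sublist-of-block b y T T⊆
  ... | T≡ , j≤y = 0 , length T , T≡ , z≤n , j≤y
  sublist-of-two-blocks a b (suc x) y T (.a ∷ʳ T⊆) with sublist-of-two-blocks a b x y T T⊆
  ... | i , j , T≡ , i≤x , j≤y = i , j , T≡ , m≤n⇒m≤1+n i≤x , j≤y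
  sublist-of-two-blocks a b (suc x) y (.a ∷ T) (refl ∷ T⊆) with sublist-of-two-blocks a b x y T T⊆
  ... | i , j , T≡ , i≤x , j≤y = suc i , j , cong (a ∷_) T≡ , s≤s i≤x , j≤y

  length-two-blocks : (a b : A) (i j : ℕ) → length (replicate i a ++ replicate j b) ≡ i + j
  length-two-blocks a b i j =
    trans (length-++ (replicate i a)) (cong₂ _+_ (length-replicate i) (length-replicate j))

sum-replicate : (i u : ℕ) → sum (replicate i u) ≡ i * u
sum-replicate zero u = refl
sum-replicate (suc i) u = cong (u +_) (sum-replicate i u)

sum-two-blocks : {A : Set} (f : A → ℕ) (a b : A) (i j : ℕ) →
  sum (map f (replicate i a ++ replicate j b)) ≡ i * f a + j * f b
sum-two-blocks f a b i j = begin
  sum (map f (replicate i a ++ replicate j b))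
    ≡⟨ cong sum (map-++ f (replicate i a) (replicate j b)) ⟩
  sum (map f (replicate i a) ++ map f (replicate j b))
    ≡⟨ sum-++ (map f (replicate i a)) (map f (replicate j b)) ⟩
  sum (map f (replicate i a)) + sum (map f (replicate j b))
    ≡⟨ cong₂ _+_ (cong sum (map-replicate f i a)) (cong sum (map-replicate f j b)) ⟩
  sum (replicate i (f a)) + sum (replicate j (f b))
    ≡⟨ cong₂ _+_ (sum-replicate i (f a)) (sum-replicate j (f b)) ⟩
  i * f a + j * f b ∎
  where open ≡-Reasoning

divisible-remainder-is-zero : (n u j : ℕ) → j < n → n ∣ n * u + j → j ≡ 0
divisible-remainder-is-zero n u zero j<n n∣ = refl
divisible-remainder-is-zero n u (suc j) j<n n∣ =
  ⊥-elim (<⇒≱ j<n (∣⇒≤ (∣m+n∣m⇒∣n n∣ (m∣m*n u))))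

-- A length-n subsequence
-- aⁱ bʲ has second coordinate sum n·u + j with j ≤ y < n, so zero-sum forces
-- j = 0 and then i = n > x.
two-blocks-avoid-length-n : {k n : ℕ} (a b : G k n) (x y : ℕ) →
  toℕ (proj₂ b) ≡ suc (toℕ (proj₂ a)) → x < n → y < n →
  NoZeroSumSubsequenceOfLength k n (replicate x a ++ replicate y b)
two-blocks-avoid-length-n {k} {n} a b x y b≡a+1 x<n y<n T T⊆ |T|≡n (_ , n∣sum₂)
  with sublist-of-two-blocks a b x y T T⊆
... | i , j , refl , i≤x , j≤y = <⇒≱ x<n (subst (_≤ x) i≡n i≤x)
  where
    u = toℕ (proj₂ a)
    i+j≡n : i + j ≡ n
    i+j≡n = trans (sym (length-two-blocks a b i j)) |T|≡n
    sum₂≡ : sum (map (λ g → toℕ (proj₂ g)) T) ≡ n * u + j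
    sum₂≡ = begin
      sum (map (λ g → toℕ (proj₂ g)) T) ≡⟨ sum-two-blocks (λ g → toℕ (proj₂ g)) a b i j ⟩
      i * u + j * toℕ (proj₂ b)         ≡⟨ cong (λ w → i * u + j * w) b≡a+1 ⟩
      i * u + j * suc u                 ≡⟨ regroup i j u ⟩
      (i + j) * u + j                   ≡⟨ cong (λ m → m * u + j) i+j≡n ⟩
      n * u + j                         ∎
      where
        open ≡-Reasoning
        regroup : ∀ i j u → i * u + j * suc u ≡ (i + j) * u + j
        regroup = solve-∀
    j≡0 : j ≡ 0
    j≡0 = divisible-remainder-is-zero n u j (≤-<-trans j≤y y<n) (subst (n ∣_) sum₂≡ n∣sum₂)
    i≡n : i ≡ n
    i≡n = trans (sym (+-identityʳ i)) (trans (cong (i +_) (sym j≡0)) i+j≡n)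

witness-above : (k m ℓ : ℕ) → suc m < ℓ → Witness (suc k) (suc m) ℓ
witness-above k m ℓ n<ℓ = S , length-replicate L , zero-sum , too-short
  where
    n = suc m
    L = 2 * n ∸ ℓ
    S = replicate L (fzero , fzero)
    sum-zero : (f : G (suc k) n → ℕ) → f (fzero , fzero) ≡ 0 → sum (map f S) ≡ 0
    sum-zero f f0≡0 = trans (cong sum (map-replicate f L (fzero , fzero)))
      (trans (sum-replicate L _) (trans (cong (L *_) f0≡0) (*-zeroʳ L)))
    zero-sum : ZeroSum (suc k) n S
    zero-sum = subst (suc k ∣_) (sym (sum-zero _ refl)) (_ ∣0)
             , subst (n ∣_) (sym (sum-zero _ refl)) (_ ∣0)
    2n∸[n+1]≡m : 2 * n ∸ suc n ≡ m
    2n∸[n+1]≡m = trans (cong (λ t → suc m + t ∸ suc n) (+-identityʳ (suc m))) (m+n∸n≡m m (suc m))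
    L<n : L < n
    L<n = s≤s (subst (L ≤_) 2n∸[n+1]≡m (∸-monoʳ-≤ (2 * n) n<ℓ))
    too-short : NoZeroSumSubsequenceOfLength (suc k) n S
    too-short T T⊆S |T|≡n _ = <⇒≱ L<n (subst (_≤ L) |T|≡n
      (subst (length T ≤_) (length-replicate L) (length-mono-≤ T⊆S)))

-- Case n = Qℓ + R with Q = q + 1, R = r + 1 and ℓ = R + s + 1 (so 1 ≤ R < ℓ):
-- the two-block sequence aˣ bʸ described in the opening comment, where the
-- second coordinates of a and b are u = n − Q − 1 and u + 1.
witness-two-blocks : (k q r s : ℕ) →
  Witness (suc k) (suc q * (2 + r + s) + suc r) (2 + r + s)
witness-two-blocks k q r s =
  S , |S|≡2n∸ℓ , zero-sum , two-blocks-avoid-length-n a b x y b≡a+1 x<n y<n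
  where
    ℓ = 2 + r + s
    n = suc q * ℓ + suc r
    u = suc q * suc (r + s) + r
    x = suc q * ℓ
    y = q * ℓ + 2 * suc r
    n≡u+1+Q : n ≡ suc u + suc q
    n≡u+1+Q = identity q r s
      where
        identity : ∀ q r s → suc q * (2 + r + s) + suc r ≡ suc (suc q * suc (r + s) + r) + suc q
        identity = solve-∀
    n≡y+[ℓ∸R] : n ≡ y + suc s
    n≡y+[ℓ∸R] = identity q r s
      where
        identity : ∀ q r s → suc q * (2 + r + s) + suc r ≡ (q * (2 + r + s) + 2 * suc r) + suc s
        identity = solve-∀
    x+y+ℓ≡2n : x + y + ℓ ≡ 2 * n
    x+y+ℓ≡2n = identity q r s
      where
        identity : ∀ q r s → suc q * (2 + r + s) + (q * (2 + r + s) + 2 * suc r) + (2 + r + s)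
                             ≡ 2 * (suc q * (2 + r + s) + suc r)
        identity = solve-∀
    -- the quotient K equals 2(n − Q) − ℓ
    K = (2 * q + 1) * (r + s + 1) + 2 * r + 1
    sum₂≡Kn : x * u + y * suc u ≡ K * n
    sum₂≡Kn = identity q r s
      where
        identity : ∀ q r s →
          suc q * (2 + r + s) * (suc q * suc (r + s) + r)
            + (q * (2 + r + s) + 2 * suc r) * suc (suc q * suc (r + s) + r)
          ≡ ((2 * q + 1) * (r + s + 1) + 2 * r + 1) * (suc q * (2 + r + s) + suc r)
        identity = solve-∀
    u+1<n : suc u < n
    u+1<n = subst (suc u <_) (sym n≡u+1+Q) (m<m+n (suc u) (s≤s z≤n))
    u<n : u < n
    u<n = <-trans (n<1+n u) u+1<n
    a b : G (suc k) n
    a = fzero , fromℕ< u<n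
    b = fzero , fromℕ< u+1<n
    b≡a+1 : toℕ (proj₂ b) ≡ suc (toℕ (proj₂ a))
    b≡a+1 = trans (toℕ-fromℕ< u+1<n) (cong suc (sym (toℕ-fromℕ< u<n)))
    x<n : x < n
    x<n = m<m+n x (s≤s z≤n)
    y<n : y < n
    y<n = subst (y <_) (sym n≡y+[ℓ∸R]) (m<m+n y (s≤s z≤n))
    S = replicate x a ++ replicate y b
    |S|≡2n∸ℓ : length S ≡ 2 * n ∸ ℓ
    |S|≡2n∸ℓ = trans (length-two-blocks a b x y)
      (trans (sym (m+n∸n≡m (x + y) ℓ)) (cong (_∸ ℓ) x+y+ℓ≡2n))
    zero-sum : ZeroSum (suc k) n S
    zero-sum =
        subst (suc k ∣_)
          (sym (trans (sum-two-blocks (λ g → toℕ (proj₁ g)) a b x y) (cong₂ _+_ (*-zeroʳ x) (*-zeroʳ y))))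
          (_ ∣0)
      , divides K (trans (sum-two-blocks (λ g → toℕ (proj₂ g)) a b x y)
          (trans (cong₂ (λ p p′ → x * p + y * p′) (toℕ-fromℕ< u<n) (toℕ-fromℕ< u+1<n)) sum₂≡Kn))

-- Case ℓ < n with ℓ ∤ n: divide n by ℓ; the remainder is nonzero since ℓ ∤ n,
-- the quotient is nonzero since ℓ < n, and the two-block construction applies.
witness-below : (k n ℓ : ℕ) → 0 < ℓ → ℓ < n → ¬ (ℓ ∣ n) → Witness (suc k) n ℓ
witness-below k n (suc ℓ′) _ ℓ<n ℓ∤n
  with n / suc ℓ′ | n % suc ℓ′ | m≡m%n+[m/n]*n n (suc ℓ′) | m%n<n n (suc ℓ′)
... | Q | zero | n≡ | _ = ⊥-elim (ℓ∤n (divides Q n≡))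
... | zero | suc r | n≡ | R<ℓ =
  ⊥-elim (<⇒≱ ℓ<n (subst (_≤ suc ℓ′) (sym (trans n≡ (+-identityʳ (suc r)))) (<⇒≤ R<ℓ)))
... | suc q | suc r | n≡ | R<ℓ with m≤n⇒∃[o]m+o≡n R<ℓ
... | s , refl = subst (λ n → Witness (suc k) n (2 + r + s))
  (sym (trans n≡ (+-comm (suc r) (suc q * (2 + r + s))))) (witness-two-blocks k q r s)

proposition3p2 : (n₁ n₂ ℓ : ℕ) → n₁ > 0 → n₂ > 0 → n₁ ∣ n₂ →
    4 ≤ ℓ → ¬ (ℓ ∣ n₂) →
    Σ (List (G n₁ n₂)) (λ S →
    (length S ≡ 2 * n₂ ∸ ℓ) × ZeroSum n₁ n₂ S ×
    ((T : List (G n₁ n₂)) → T ⊆ S → length T ≡ n₂ → ¬ ZeroSum n₁ n₂ T))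
proposition3p2 zero _ _ () _ _ _ _
proposition3p2 (suc k) n₂ ℓ _ _ _ 4≤ℓ ℓ∤n₂ with <-cmp ℓ n₂
... | tri< ℓ<n₂ _ _ = witness-below k n₂ ℓ (≤-trans (s≤s z≤n) 4≤ℓ) ℓ<n₂ ℓ∤n₂
... | tri≈ _ refl _ = ⊥-elim (ℓ∤n₂ ∣-refl)
proposition3p2 (suc k) (suc m) ℓ _ _ _ _ _ | tri> _ _ n₂<ℓ = witness-above k m ℓ n₂<ℓ
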